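{- Let $G$ be a graph with vertex set $V(G)=\{a_1,\dots,a_n\}$ and distinguishing number $D(G)=d$. For integers $m\ge k\ge1$, let $\mathcal{L}(G,m)=\{C_1,\dots,C_{t_m}\}$ be the set of all distinguishing labelings of $G$ using labels from $\{1,\dots,m\}$. Then: (1) $D_l(G)=\min\Big\{k:\ \big|B_{(m,k)}^{\{a_1,\dots,a_n\}}(C_1,\dots,C_{t_m})\big|\ge\binom{m}{k}^n \text{ for all } m\ge k\Big\}$; (2) $D_l(G)=D(G)=d$ if and only if $\big|B_{(m,d)}^{\{a_1,\dots,a_n\}}(C_1,\dots,C_{t_m})\big|\ge\binom{m}{d}^n$ for all $m\ge d$.
   Context: A labeling $\phi$ of $V(G)$ is distinguishing if the only automorphism $\sigma$ of $G$ with $\phi(\sigma(x))=\phi(x)$ for all $x$ is the identity. $D(G)$ is the least number of labels in a distinguishing labeling. A list assignment $L=\{L(v)\}_{v\in V(G)}$ gives each vertex a set of labels. A distinguishing $L$-labeling is a distinguishing labeling in which each vertex $v$ receives a label from $L(v)$. $D_l(G)$ is the least $k$ such that every list assignment with $|L(v)|=k$ for all $v$ admits a distinguishing $L$-labeling. For a labeling $C:V(G)\to\{1,\dots,m\}$, $\mathcal{L}^{\{a_1,\dots,a_n\}}_{(m,k)}(C)$ is the set of all sequences $\{L_i\}_{i=1}^n$ with $L_i\subseteq\{1,\dots,m\}$, $|L_i|=k$ and $C(a_i)\in L_i$ for all $i$. Then $$B_{(m,k)}^{\{a_1,\dots,a_n\}}(C_1,\dots,C_t)=\bigcup_{j=1}^t\mathcal{L}^{\{a_1,\dots,a_n\}}_{(m,k)}(C_j).$$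 -}

module Defs where

open import Data.Nat using (ℕ; _≤_; _^_)
open import Data.Nat.Combinatorics using (_C_)
open import Data.Fin using (Fin)
open import Data.Fin.Subset using (Subset; _∈_; ∣_∣)
open import Data.Fin.Permutation using (Permutation′; _⟨$⟩ʳ_)
open import Data.Bool using (Bool; false)
open import Data.List using (List; length)
open import Data.List.Relation.Unary.Unique.Propositional using (Unique)
import Data.List.Membership.Propositional as LM
open import Data.Vec using (Vec; lookup)
open import Data.Product using (Σ; ∃; _×_)
open import Relation.Binary.PropositionalEquality using (_≡_)

record Graph (n : ℕ) : Set where
  field
    adj     : Fin n → Fin n → Bool
    adj-sym : ∀ x y → adj x y ≡ adj y x
    adj-irr : ∀ x → adj x x ≡ false
open Graph public

IsAutomorphism : ∀ {n} → Graph n → Permutation′ n → Set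
IsAutomorphism G σ = ∀ x y → adj G (σ ⟨$⟩ʳ x) (σ ⟨$⟩ʳ y) ≡ adj G x y

IsDistinguishing : ∀ {n} {A : Set} → Graph n → (Fin n → A) → Set
IsDistinguishing {n} G φ =
  (σ : Permutation′ n) → IsAutomorphism G σ →
  (∀ x → φ (σ ⟨$⟩ʳ x) ≡ φ x) → ∀ x → σ ⟨$⟩ʳ x ≡ x

IsLeast : (ℕ → Set) → ℕ → Set
IsLeast P k = P k × (∀ j → P j → k ≤ j)

-- D(G) = d : least number of labels (labels {1..d} ≅ Fin d) in a distinguishing labeling.
HasDistLabeling : ∀ {n} → Graph n → ℕ → Set
HasDistLabeling {n} G k = Σ (Fin n → Fin k) λ φ → IsDistinguishing G φ

IsDistNumber : ∀ {n} → Graph n → ℕ → Set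
IsDistNumber G = IsLeast (HasDistLabeling G)

ListDist : ∀ {n} → Graph n → ℕ → Set
ListDist {n} G k =
  (L : Fin n → List ℕ) → (∀ v → Unique (L v)) → (∀ v → length (L v) ≡ k) →
  Σ (Fin n → ℕ) λ φ → IsDistinguishing G φ × (∀ v → φ v LM.∈ L v)

IsListDistNumber : ∀ {n} → Graph n → ℕ → Set
IsListDistNumber G = IsLeast (ListDist G)

-- Membership in B_{(m,k)}^{a_1..a_n}(C_1,...,C_{t_m}), where C_1..C_{t_m}
-- are all distinguishing labelings of G with labels {1..m} ≅ Fin m.
-- A sequence {L_i} of subsets of {1..m} is a vector of Subset m.
InB : ∀ {n} → Graph n → (m k : ℕ) → Vec (Subset m) n → Set
InB {n} G m k Ls =
  (∀ i → ∣ lookup Ls i ∣ ≡ k) ×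
  Σ (Fin n → Fin m) λ C → IsDistinguishing G C × (∀ i → C i ∈ lookup Ls i)

-- |S| ≥ N for a subset S of the finite set Vec (Subset m) n:
-- there is an injection of Fin N into S.
AtLeast : ∀ {n m} → (Vec (Subset m) n → Set) → ℕ → Set
AtLeast {n} {m} S N =
  Σ (Fin N → Vec (Subset m) n) λ f →
    (∀ x y → f x ≡ f y → x ≡ y) × (∀ x → S (f x))

BigB : ∀ {n} → Graph n → (m k : ℕ) → Set
BigB {n} G m k = AtLeast (InB G m k) ((m C k) ^ n)

module Submission where

-- Write BoundedListDist G m k for: every assignment of k-subsets of {0,…,m-1} to
-- the vertices of G admits a distinguishing labeling choosing each label from its
-- vertex's subset.  The proof has three ingredients.
--  (a) Counting.  The vectors of n subsets of Fin m of size k are enumerated by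
--      Fin ((m C k)^n) (Pascal's rule and products of enumerations), and a family
--      inside an N-element family that contains N distinct members is the whole
--      family (an injective self-map of Fin N is onto).  Since B_(m,k) consists of
--      such vectors, |B_(m,k)| ≥ (m C k)^n iff BoundedListDist G m k.
--  (b) Lists versus subsets.  A k-subset of Fin m is a duplicate-free list of k
--      naturals, and finitely many duplicate-free lists of length k are k-subsets
--      of Fin m for m large.  Hence ListDist G k iff BoundedListDist G m k for all
--      m ≥ k.
--  (c) D_l(G) ≥ 1 when G has a vertex, and D(G) ≤ D_l(G) (give every vertex the
--      list {0,…,k-1}).
-- Part (1) then holds because "least element" respects pointwise equivalence of
-- predicates, and part (2) because D(G) ≤ D_l(G) turns "D_l(G) = D(G)" into
-- ListDist G (D(G)).

open import Defs
open import Data.Nat using (ℕ; _≤_)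
open import Data.Product using (_×_)
open import Function.Bundles using (_⇔_)

open import Data.Nat using (zero; suc; _+_; _^_; _<_; s≤s; z≤n)
open import Data.Nat.Properties
  using (suc-injective; 0≢1+n; +-suc; n≮0; ≤-pred; ≤-trans; m≤m+n; m≤n+m; 1+n≰n)
open import Data.Nat.Combinatorics using (_C_; k>n⇒nCk≡0; nCk+nC[k+1]≡[n+1]C[k+1])
open import Data.Nat.ListAction using (sum)
open import Data.Fin as Fin using (Fin; toℕ; punchOut)
open import Data.Fin.Properties
  using (toℕ-injective; punchOut-injective; any?; injective⇒≤; _≟_; 1↔⊤; +↔⊎; *↔×)
open import Data.Fin.Subset using (Subset; ∣_∣; _∈_; ⊥; ⊤; inside; outside)
open import Data.Fin.Subset.Properties using (∣⊤∣≡n; ∣⊥∣≡0)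
open import Data.Bool using (Bool; true; false)
open import Data.Unit using (tt)
open import Data.Vec as Vec using (Vec; []; _∷_; lookup; tabulate; replicate; here; there)
open import Data.Vec.Properties using (lookup∘tabulate; lookup-replicate; []=⇒lookup)
open import Data.List using (List; []; _∷_; length; map; concat; allFin)
open import Data.List.Properties using (length-map)
open import Data.List.Membership.Propositional using () renaming (_∈_ to _∈ˡ_)
open import Data.List.Membership.Propositional.Properties
  using (∈-map⁺; ∈-map⁻; ∈-allFin; ∈-concat⁺′)
open import Data.List.Relation.Unary.Any as Any using ()
open import Data.List.Relation.Unary.All as All using (All)
open import Data.List.Relation.Unary.AllPairs using ([]; _∷_)
open import Data.List.Relation.Unary.Unique.Propositional using (Unique)
import Data.List.Relation.Unary.Unique.Propositional.Properties as Unique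
open import Data.Product using (Σ; _,_; proj₁; proj₂; uncurry)
open import Data.Sum using (_⊎_; inj₁; inj₂; [_,_]′)
open import Data.Sum.Properties using (inj₁-injective; inj₂-injective)
open import Data.Empty using (⊥-elim)
open import Function using (_∘_)
open import Function.Bundles using (_↔_; Inverse; mk⇔; Equivalence)
open import Relation.Nullary using (yes; no; ¬_)
open import Relation.Binary.PropositionalEquality
  using (_≡_; refl; sym; trans; cong; cong₂; subst; module ≡-Reasoning)


-- An I-indexed enumeration of P: a bijection between I and the elements
-- satisfying P.  Counting statements are phrased with I = Fin N.
record Enumeration {A : Set} (P : A → Set) (I : Set) : Set where
  field
    elem     : I → A
    distinct : ∀ i j → elem i ≡ elem j → i ≡ j
    sound    : ∀ i → P (elem i)
    complete : ∀ a → P a → Σ I λ i → elem i ≡ a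
open Enumeration

reindex : ∀ {A I J : Set} {P : A → Set} → J ↔ I → Enumeration P I → Enumeration P J
reindex e E = record
  { elem     = elem E ∘ to
  ; distinct = λ i j eq →
      trans (sym (strictlyInverseʳ i))
        (trans (cong from (distinct E (to i) (to j) eq)) (strictlyInverseʳ j))
  ; sound    = sound E ∘ to
  ; complete = λ a p → let (i , eᵢ≡a) = complete E a p in
      from i , trans (cong (elem E) (strictlyInverseˡ i)) eᵢ≡a
  }
  where open Inverse e

module _ {A B : Set} {P : A → Set} {Q : B → Set} where

  map-enumeration : ∀ {I : Set} (f : A → B) → (∀ a a′ → f a ≡ f a′ → a ≡ a′) →
    (∀ a → P a → Q (f a)) → (∀ b → Q b → Σ A λ a → P a × f a ≡ b) →
    Enumeration P I → Enumeration Q I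
  map-enumeration f f-inj f-sound f-onto E = record
    { elem     = f ∘ elem E
    ; distinct = λ i j eq → distinct E i j (f-inj _ _ eq)
    ; sound    = λ i → f-sound _ (sound E i)
    ; complete = λ b q → let (a , p , fa≡b) = f-onto b q ; (i , eᵢ≡a) = complete E a p in
        i , trans (cong f eᵢ≡a) fa≡b
    }

  ⊎-enumeration : ∀ {I J : Set} → Enumeration P I → Enumeration Q J →
    Enumeration [ P , Q ]′ (I ⊎ J)
  ⊎-enumeration E F = record
    { elem     = Data.Sum.map (elem E) (elem F)
    ; distinct = λ { (inj₁ i) (inj₁ j) eq → cong inj₁ (distinct E i j (inj₁-injective eq))
                   ; (inj₂ i) (inj₂ j) eq → cong inj₂ (distinct F i j (inj₂-injective eq))
                   ; (inj₁ i) (inj₂ j) () ; (inj₂ i) (inj₁ j) () }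
    ; sound    = λ { (inj₁ i) → sound E i ; (inj₂ j) → sound F j }
    ; complete = λ { (inj₁ a) p → let (i , eq) = complete E a p in inj₁ i , cong inj₁ eq
                   ; (inj₂ b) q → let (j , eq) = complete F b q in inj₂ j , cong inj₂ eq }
    }

  ×-enumeration : ∀ {I J : Set} → Enumeration P I → Enumeration Q J →
    Enumeration (λ (ab : A × B) → P (proj₁ ab) × Q (proj₂ ab)) (I × J)
  ×-enumeration E F = record
    { elem     = Data.Product.map (elem E) (elem F)
    ; distinct = λ (i , j) (i′ , j′) eq →
        cong₂ _,_ (distinct E i i′ (cong proj₁ eq)) (distinct F j j′ (cong proj₂ eq))
    ; sound    = λ (i , j) → sound E i , sound F j
    ; complete = λ (a , b) (p , q) → let (i , eᵢ) = complete E a p ; (j , fⱼ) = complete F b q in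
        (i , j) , cong₂ _,_ eᵢ fⱼ
    }

-- Pigeonhole principle, surjective form: an injective self-map of Fin N is onto.
-- Otherwise it would miss some y, and punching y out gives Fin (1+N′) ↣ Fin N′.
injective⇒surjective : ∀ {N} (g : Fin N → Fin N) → (∀ x y → g x ≡ g y → x ≡ y) →
  ∀ y → Σ (Fin N) λ x → g x ≡ y
injective⇒surjective {suc N′} g g-inj y with any? (λ x → g x ≟ y)
... | yes hit = hit
... | no miss = ⊥-elim (1+n≰n (injective⇒≤ {f = h} h-inj))
  where
  y≢g : ∀ x → ¬ y ≡ g x
  y≢g x y≡gx = miss (x , sym y≡gx)
  h : Fin (suc N′) → Fin N′
  h x = punchOut (y≢g x)
  h-inj : ∀ {x z} → h x ≡ h z → x ≡ z
  h-inj {x} {z} eq = g-inj x z (punchOut-injective (y≢g x) (y≢g z) eq)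

injection⇒full : ∀ {A : Set} {P S : A → Set} {N} → Enumeration P (Fin N) →
  (∀ a → S a → P a) → (f : Fin N → A) → (∀ x y → f x ≡ f y → x ≡ y) →
  (∀ x → S (f x)) → ∀ a → P a → S a
injection⇒full {S = S} {N} E S⊆P f f-inj f∈S a pa = subst S fx≡a (f∈S x)
  where
  index : Fin N → Fin N
  index x = proj₁ (complete E (f x) (S⊆P _ (f∈S x)))
  elem-index : ∀ x → elem E (index x) ≡ f x
  elem-index x = proj₂ (complete E (f x) (S⊆P _ (f∈S x)))
  index-inj : ∀ x y → index x ≡ index y → x ≡ y
  index-inj x y eq = f-inj x y (trans (sym (elem-index x)) (trans (cong (elem E) eq) (elem-index y)))
  -- Being onto, index hits the position of a.
  position : Σ (Fin N) λ i → elem E i ≡ a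
  position = complete E a pa
  preimage : Σ (Fin N) λ x → index x ≡ proj₁ position
  preimage = injective⇒surjective index index-inj (proj₁ position)
  x : Fin N
  x = proj₁ preimage
  fx≡a : f x ≡ a
  fx≡a = begin
    f x                        ≡⟨ sym (elem-index x) ⟩
    elem E (index x)           ≡⟨ cong (elem E) (proj₂ preimage) ⟩
    elem E (proj₁ position)    ≡⟨ proj₂ position ⟩
    a                          ∎
    where open ≡-Reasoning

full⇒injection : ∀ {A : Set} {P S : A → Set} {N} → Enumeration P (Fin N) →
  (∀ a → P a → S a) → Σ (Fin N → A) λ f → (∀ x y → f x ≡ f y → x ≡ y) × (∀ x → S (f x))
full⇒injection E P⊆S = elem E , distinct E , λ x → P⊆S _ (sound E x)


∣p∣≡0⇒p≡⊥ : ∀ {m} (p : Subset m) → ∣ p ∣ ≡ 0 → p ≡ ⊥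
∣p∣≡0⇒p≡⊥ [] _ = refl
∣p∣≡0⇒p≡⊥ (outside ∷ p) eq = cong (outside ∷_) (∣p∣≡0⇒p≡⊥ p eq)

OfSize : ∀ {m} → ℕ → Subset m → Set
OfSize k p = ∣ p ∣ ≡ k

-- The subsets of Fin m of size k are enumerated by Fin (m C k), by Pascal's rule:
-- a (k+1)-subset of Fin (m+1) either contains 0 (and k further elements) or not.
subsetsOfSize : ∀ m k → Enumeration (OfSize {m} k) (Fin (m C k))
subsetsOfSize m zero = reindex 1↔⊤ record
  { elem     = λ _ → ⊥
  ; distinct = λ _ _ _ → refl
  ; sound    = λ _ → ∣⊥∣≡0 m
  ; complete = λ p ∣p∣≡0 → tt , sym (∣p∣≡0⇒p≡⊥ p ∣p∣≡0)
  }
subsetsOfSize zero (suc k) =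
  subst (λ N → Enumeration (OfSize {0} (suc k)) (Fin N)) (sym (k>n⇒nCk≡0 {0} {suc k} (s≤s z≤n)))
    record { elem = λ () ; distinct = λ () ; sound = λ () ; complete = λ { [] () } }
subsetsOfSize (suc m) (suc k) =
  subst (λ N → Enumeration (OfSize {suc m} (suc k)) (Fin N)) (nCk+nC[k+1]≡[n+1]C[k+1] m k)
    (reindex +↔⊎ (map-enumeration extend extend-inj extend-sound extend-onto
      (⊎-enumeration (subsetsOfSize m k) (subsetsOfSize m (suc k)))))
  where
  extend : Subset m ⊎ Subset m → Subset (suc m)
  extend = [ inside ∷_ , outside ∷_ ]′
  extend-inj : ∀ p q → extend p ≡ extend q → p ≡ q
  extend-inj (inj₁ p) (inj₁ q) eq = cong inj₁ (cong Vec.tail eq)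
  extend-inj (inj₂ p) (inj₂ q) eq = cong inj₂ (cong Vec.tail eq)
  extend-inj (inj₁ p) (inj₂ q) ()
  extend-inj (inj₂ p) (inj₁ q) ()
  extend-sound : ∀ p → [ OfSize k , OfSize (suc k) ]′ p → ∣ extend p ∣ ≡ suc k
  extend-sound (inj₁ p) ∣p∣≡k = cong suc ∣p∣≡k
  extend-sound (inj₂ p) ∣p∣≡1+k = ∣p∣≡1+k
  extend-onto : ∀ q → ∣ q ∣ ≡ suc k →
    Σ (Subset m ⊎ Subset m) λ p → [ OfSize k , OfSize (suc k) ]′ p × extend p ≡ q
  extend-onto (inside ∷ q) eq = inj₁ q , suc-injective eq , refl
  extend-onto (outside ∷ q) eq = inj₂ q , eq , refl

vectorsOf : ∀ {A : Set} {P : A → Set} {c} n → Enumeration P (Fin c) →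
  Enumeration (λ (v : Vec A n) → ∀ i → P (lookup v i)) (Fin (c ^ n))
vectorsOf zero E = reindex 1↔⊤ record
  { elem = λ _ → [] ; distinct = λ _ _ _ → refl ; sound = λ _ () ; complete = λ { [] _ → tt , refl } }
vectorsOf {A} {P} (suc n) E =
  reindex *↔× (map-enumeration (uncurry _∷_) cons-inj cons-sound cons-onto
    (×-enumeration E (vectorsOf n E)))
  where
  cons-inj : ∀ u w → uncurry _∷_ u ≡ uncurry _∷_ w → u ≡ w
  cons-inj _ _ eq = cong₂ _,_ (cong Vec.head eq) (cong Vec.tail eq)
  cons-sound : ∀ u → P (proj₁ u) × (∀ i → P (lookup (proj₂ u) i)) →
    ∀ i → P (lookup (uncurry _∷_ u) i)
  cons-sound _ (p , ps) Fin.zero = p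
  cons-sound _ (p , ps) (Fin.suc i) = ps i
  cons-onto : ∀ v → (∀ i → P (lookup v i)) →
    Σ (A × Vec A n) λ u → (P (proj₁ u) × (∀ i → P (lookup (proj₂ u) i))) × uncurry _∷_ u ≡ v
  cons-onto (a ∷ v) ps = (a , v) , (ps Fin.zero , ps ∘ Fin.suc) , refl


BoundedListDist : ∀ {n} → Graph n → (m k : ℕ) → Set
BoundedListDist {n} G m k = (Ls : Vec (Subset m) n) → (∀ i → ∣ lookup Ls i ∣ ≡ k) →
  Σ (Fin n → Fin m) λ χ → IsDistinguishing G χ × (∀ i → χ i ∈ lookup Ls i)

-- B_(m,k) lies inside the (m C k)^n vectors of k-subsets, so it has at least that
-- many members exactly when it contains all of them.
bigB⇔boundedListDist : ∀ {n} (G : Graph n) m k → BigB G m k ⇔ BoundedListDist G m k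
bigB⇔boundedListDist {n} G m k = mk⇔
  (λ (f , f-inj , f∈B) Ls sizes →
     proj₂ (injection⇒full vectors (λ _ → proj₁) f f-inj f∈B Ls sizes))
  (λ bounded → full⇒injection vectors (λ Ls sizes → sizes , bounded Ls sizes))
  where
  vectors : Enumeration (λ (Ls : Vec (Subset m) n) → ∀ i → OfSize k (lookup Ls i)) (Fin ((m C k) ^ n))
  vectors = vectorsOf n (subsetsOfSize m k)


-- A labeling that separates every pair of vertices separated by a distinguishing
-- labeling is distinguishing: an automorphism preserving it preserves the other.
finer⇒distinguishing : ∀ {n} {A B : Set} (G : Graph n) (φ : Fin n → A) (ψ : Fin n → B) →
  (∀ x y → φ x ≡ φ y → ψ x ≡ ψ y) → IsDistinguishing G ψ → IsDistinguishing G φ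
finer⇒distinguishing G φ ψ φ⊑ψ ψ-dist σ σ-aut φσ≡φ = ψ-dist σ σ-aut (λ x → φ⊑ψ _ _ (φσ≡φ x))


subset→list : ∀ {m} → Subset m → List ℕ
subset→list [] = []
subset→list (inside ∷ p) = 0 ∷ map suc (subset→list p)
subset→list (outside ∷ p) = map suc (subset→list p)

length-subset→list : ∀ {m} (p : Subset m) → length (subset→list p) ≡ ∣ p ∣
length-subset→list [] = refl
length-subset→list (inside ∷ p) = cong suc (trans (length-map suc (subset→list p)) (length-subset→list p))
length-subset→list (outside ∷ p) = trans (length-map suc (subset→list p)) (length-subset→list p)

unique-subset→list : ∀ {m} (p : Subset m) → Unique (subset→list p)
unique-subset→list [] = []
unique-subset→list (inside ∷ p) = All.tabulate 0∉suc ∷ Unique.map⁺ suc-injective (unique-subset→list p)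
  where
  0∉suc : ∀ {y} → y ∈ˡ map suc (subset→list p) → ¬ 0 ≡ y
  0∉suc y∈ 0≡y = let (_ , _ , y≡1+z) = ∈-map⁻ suc y∈ in 0≢1+n (trans 0≡y y≡1+z)
unique-subset→list (outside ∷ p) = Unique.map⁺ suc-injective (unique-subset→list p)

∈-subset→list : ∀ {m} (p : Subset m) {x} → x ∈ˡ subset→list p →
  Σ (Fin m) λ i → i ∈ p × toℕ i ≡ x
∈-shifted : ∀ {m b} (p : Subset m) {x} → x ∈ˡ map suc (subset→list p) →
  Σ (Fin (suc m)) λ i → i ∈ b ∷ p × toℕ i ≡ x

∈-subset→list (inside ∷ p) (Any.here x≡0) = Fin.zero , here , sym x≡0
∈-subset→list (inside ∷ p) (Any.there x∈) = ∈-shifted p x∈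
∈-subset→list (outside ∷ p) x∈ = ∈-shifted p x∈

∈-shifted p x∈ with ∈-map⁻ suc x∈
... | y , y∈ , refl =
  let (i , i∈p , i≡y) = ∈-subset→list p y∈ in Fin.suc i , there i∈p , cong suc i≡y

has0 : List ℕ → Bool
has0 [] = false
has0 (zero ∷ l) = true
has0 (suc _ ∷ l) = has0 l

predecessors : List ℕ → List ℕ
predecessors [] = []
predecessors (zero ∷ l) = predecessors l
predecessors (suc x ∷ l) = x ∷ predecessors l

list→subset : ∀ m → List ℕ → Subset m
list→subset zero l = []
list→subset (suc m) l = has0 l ∷ list→subset m (predecessors l)

has0⇒0∈ : ∀ l → has0 l ≡ true → 0 ∈ˡ l
has0⇒0∈ (zero ∷ l) _ = Any.here refl
has0⇒0∈ (suc _ ∷ l) 0∈ = Any.there (has0⇒0∈ l 0∈)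

0∉⇒¬has0 : ∀ l → All (λ y → ¬ 0 ≡ y) l → has0 l ≡ false
0∉⇒¬has0 [] _ = refl
0∉⇒¬has0 (zero ∷ l) (0≢0 All.∷ _) = ⊥-elim (0≢0 refl)
0∉⇒¬has0 (suc _ ∷ l) (_ All.∷ 0∉l) = 0∉⇒¬has0 l 0∉l

∈-predecessors : ∀ l {y} → y ∈ˡ predecessors l → suc y ∈ˡ l
∈-predecessors (zero ∷ l) y∈ = Any.there (∈-predecessors l y∈)
∈-predecessors (suc x ∷ l) (Any.here y≡x) = Any.here (cong suc y≡x)
∈-predecessors (suc x ∷ l) (Any.there y∈) = Any.there (∈-predecessors l y∈)

unique-predecessors : ∀ l → Unique l → Unique (predecessors l)
unique-predecessors [] _ = []
unique-predecessors (zero ∷ l) (_ ∷ l!) = unique-predecessors l l!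
unique-predecessors (suc x ∷ l) (x∉l ∷ l!) =
  All.tabulate (λ y∈ x≡y → All.lookup x∉l (∈-predecessors l y∈) (cong suc x≡y))
    ∷ unique-predecessors l l!

-- For a duplicate-free list, |l| = [0 ∈ l] + |predecessors l|.  The indicator
-- [b] is written ∣ b ∷ [] ∣, the size of the one-point subset b.
length-split : ∀ l → Unique l → length l ≡ ∣ has0 l ∷ [] ∣ + length (predecessors l)
length-split [] _ = refl
length-split (zero ∷ l) (0∉l ∷ l!) =
  cong suc (trans (length-split l l!)
    (cong (λ b → ∣ b ∷ [] ∣ + length (predecessors l)) (0∉⇒¬has0 l 0∉l)))
length-split (suc x ∷ l) (_ ∷ l!) =
  trans (cong suc (length-split l l!)) (sym (+-suc ∣ has0 l ∷ [] ∣ (length (predecessors l))))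

∣b∷p∣ : ∀ {m} b (p : Subset m) → ∣ b ∷ p ∣ ≡ ∣ b ∷ [] ∣ + ∣ p ∣
∣b∷p∣ inside p = refl
∣b∷p∣ outside p = refl

∣list→subset∣ : ∀ m l → Unique l → (∀ {y} → y ∈ˡ l → y < m) →
  ∣ list→subset m l ∣ ≡ length l
∣list→subset∣ zero [] _ _ = refl
∣list→subset∣ zero (x ∷ l) _ l<0 = ⊥-elim (n≮0 (l<0 (Any.here refl)))
∣list→subset∣ (suc m) l l! l<1+m = begin
  ∣ has0 l ∷ list→subset m (predecessors l) ∣
    ≡⟨ ∣b∷p∣ (has0 l) (list→subset m (predecessors l)) ⟩
  ∣ has0 l ∷ [] ∣ + ∣ list→subset m (predecessors l) ∣
    ≡⟨ cong (∣ has0 l ∷ [] ∣ +_) rest ⟩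
  ∣ has0 l ∷ [] ∣ + length (predecessors l)
    ≡⟨ sym (length-split l l!) ⟩
  length l
    ∎
  where
  open ≡-Reasoning
  rest : ∣ list→subset m (predecessors l) ∣ ≡ length (predecessors l)
  rest = ∣list→subset∣ m (predecessors l) (unique-predecessors l l!)
           (λ y∈ → ≤-pred (l<1+m (∈-predecessors l y∈)))

∈-list→subset : ∀ m l (i : Fin m) → i ∈ list→subset m l → toℕ i ∈ˡ l
∈-list→subset m l i i∈ = lookup-true m l i ([]=⇒lookup i∈)
  where
  lookup-true : ∀ m l (i : Fin m) → lookup (list→subset m l) i ≡ true → toℕ i ∈ˡ l
  lookup-true (suc m) l Fin.zero 0∈ = has0⇒0∈ l 0∈
  lookup-true (suc m) l (Fin.suc i) i∈ = ∈-predecessors l (lookup-true m (predecessors l) i i∈)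


-- Lists drawn from subsets of Fin m are an instance of arbitrary k-lists.
listDist⇒boundedListDist : ∀ {n} (G : Graph n) k → ListDist G k → ∀ m → BoundedListDist G m k
listDist⇒boundedListDist {n} G k listDist m Ls sizes =
  fromLists (listDist (subset→list ∘ lookup Ls) (unique-subset→list ∘ lookup Ls)
                      (λ v → trans (length-subset→list (lookup Ls v)) (sizes v)))
  where
  fromLists :
    Σ (Fin n → ℕ) (λ φ → IsDistinguishing G φ × (∀ v → φ v ∈ˡ subset→list (lookup Ls v))) →
    Σ (Fin n → Fin m) λ χ → IsDistinguishing G χ × (∀ v → χ v ∈ lookup Ls v)
  fromLists (φ , φ-dist , φ∈) =
    χ , finer⇒distinguishing G χ φ χ⊑φ φ-dist , proj₁ ∘ proj₂ ∘ element
    where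
    element : ∀ v → Σ (Fin m) λ i → i ∈ lookup Ls v × toℕ i ≡ φ v
    element v = ∈-subset→list (lookup Ls v) (φ∈ v)
    χ : Fin n → Fin m
    χ = proj₁ ∘ element
    χ⊑φ : ∀ x y → χ x ≡ χ y → φ x ≡ φ y
    χ⊑φ x y χx≡χy =
      trans (sym (proj₂ (proj₂ (element x)))) (trans (cong toℕ χx≡χy) (proj₂ (proj₂ (element y))))

∈⇒≤sum : ∀ {x} l → x ∈ˡ l → x ≤ sum l
∈⇒≤sum (y ∷ l) (Any.here refl) = m≤m+n y (sum l)
∈⇒≤sum (y ∷ l) (Any.there x∈) = ≤-trans (∈⇒≤sum l x∈) (m≤n+m (sum l) y)

-- Conversely, all labels occurring in a k-list assignment lie below some m ≥ k,
-- making it an assignment of k-subsets of Fin m.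
boundedListDist⇒listDist : ∀ {n} (G : Graph n) k →
  (∀ m → k ≤ m → BoundedListDist G m k) → ListDist G k
boundedListDist⇒listDist {n} G k bounded L L! |L|≡k = toLists (bounded m (m≤n+m k B) Ls sizes)
  where
  allLabels : List ℕ
  allLabels = concat (map L (allFin n))
  B m : ℕ
  B = suc (sum allLabels)
  m = B + k
  label<m : ∀ v {y} → y ∈ˡ L v → y < m
  label<m v y∈ =
    ≤-trans (s≤s (∈⇒≤sum allLabels (∈-concat⁺′ y∈ (∈-map⁺ L (∈-allFin v))))) (m≤m+n B k)
  Ls : Vec (Subset m) n
  Ls = tabulate (λ v → list→subset m (L v))
  lookup-Ls : ∀ v → lookup Ls v ≡ list→subset m (L v)
  lookup-Ls = lookup∘tabulate (λ v → list→subset m (L v))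
  sizes : ∀ v → ∣ lookup Ls v ∣ ≡ k
  sizes v = trans (cong ∣_∣ (lookup-Ls v)) (trans (∣list→subset∣ m (L v) (L! v) (label<m v)) (|L|≡k v))
  toLists : Σ (Fin n → Fin m) (λ χ → IsDistinguishing G χ × (∀ v → χ v ∈ lookup Ls v)) →
    Σ (Fin n → ℕ) λ φ → IsDistinguishing G φ × (∀ v → φ v ∈ˡ L v)
  toLists (χ , χ-dist , χ∈) =
    toℕ ∘ χ , finer⇒distinguishing G (toℕ ∘ χ) χ (λ _ _ → toℕ-injective) χ-dist ,
    λ v → ∈-list→subset m (L v) (χ v) (subst (χ v ∈_) (lookup-Ls v) (χ∈ v))


listDist⇔bigB : ∀ {n} (G : Graph n) k → ListDist G k ⇔ (∀ m → k ≤ m → BigB G m k)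
listDist⇔bigB G k = mk⇔
  (λ listDist m _ → from (bigB⇔boundedListDist G m k) (listDist⇒boundedListDist G k listDist m))
  (λ bigB → boundedListDist⇒listDist G k (λ m k≤m → to (bigB⇔boundedListDist G m k) (bigB m k≤m)))
  where open Equivalence

¬listDist0 : ∀ {n} (G : Graph n) → 1 ≤ n → ¬ ListDist G 0
¬listDist0 G (s≤s _) listDist with listDist (λ _ → []) (λ _ → []) (λ _ → refl)
... | _ , _ , ∈[] with ∈[] Fin.zero
... | ()

listDist⇔positiveBigB : ∀ {n} (G : Graph n) → 1 ≤ n → ∀ j →
  ListDist G j ⇔ (1 ≤ j × (∀ m → j ≤ m → BigB G m j))
listDist⇔positiveBigB G n≥1 zero = mk⇔ (⊥-elim ∘ ¬listDist0 G n≥1) (λ { (() , _) })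
listDist⇔positiveBigB G n≥1 (suc j) =
  mk⇔ (λ listDist → s≤s z≤n , to (listDist⇔bigB G (suc j)) listDist)
      (from (listDist⇔bigB G (suc j)) ∘ proj₂)
  where open Equivalence

-- D(G) ≤ D_l(G): offering every vertex all of Fin k yields a distinguishing k-labeling.
listDist⇒distLabeling : ∀ {n} (G : Graph n) k → ListDist G k → HasDistLabeling G k
listDist⇒distLabeling {n} G k listDist =
  let (χ , χ-dist , _) = listDist⇒boundedListDist G k listDist k (replicate n ⊤)
                           (λ v → trans (cong ∣_∣ (lookup-replicate v ⊤)) (∣⊤∣≡n k))
  in χ , χ-dist

isLeast-cong : ∀ {P Q : ℕ → Set} → (∀ j → P j ⇔ Q j) → ∀ k → IsLeast P k ⇔ IsLeast Q k
isLeast-cong P⇔Q k = mk⇔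
  (λ (pk , least) → to (P⇔Q k) pk , λ j qj → least j (from (P⇔Q j) qj))
  (λ (qk , least) → from (P⇔Q k) qk , λ j pj → least j (to (P⇔Q j) pj))
  where open Equivalence


mainTheorem5 : (n : ℕ) → (G : Graph n) → 1 ≤ n →
    ((k : ℕ) → IsListDistNumber G k ⇔ IsLeast (λ j → 1 ≤ j × ((m : ℕ) → j ≤ m → BigB G m j)) k)
    × ((d : ℕ) → IsDistNumber G d → (IsListDistNumber G d ⇔ ((m : ℕ) → d ≤ m → BigB G m d)))
mainTheorem5 n G n≥1 = part1 , part2
  where
  open Equivalence
  part1 : (k : ℕ) → IsListDistNumber G k ⇔ IsLeast (λ j → 1 ≤ j × ((m : ℕ) → j ≤ m → BigB G m j)) k
  part1 = isLeast-cong (listDist⇔positiveBigB G n≥1)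
  -- (2): since D(G) = d ≤ D_l(G), D_l(G) = d amounts to ListDist G d.
  part2 : (d : ℕ) → IsDistNumber G d → (IsListDistNumber G d ⇔ ((m : ℕ) → d ≤ m → BigB G m d))
  part2 d (_ , d-least) = mk⇔
    (λ (listDist , _) → to (listDist⇔bigB G d) listDist)
    (λ bigB → from (listDist⇔bigB G d) bigB ,
              λ j listDist → d-least j (listDist⇒distLabeling G j listDist))
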